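{- Let $\mathcal{A}$ be a $\mathbf{tDL}$-algebra. The following are equivalent: (a) for every $X\in\mathcal{P}(A)\setminus\{\emptyset,\{0\},\{1\}\}$ and every $a\in A$ there are $x_1,\dots,x_{n_a},y_1,\dots,y_{m_a}\in X$ and $p_a,q_a\in\omega$ such that $d^{p_a}\left(\bigwedge_{i=1}^{n_a}x_i\right)\le a\le\hat{d}^{q_a}\left(\bigvee_{j=1}^{m_a}y_j\right)$; (b) for every $a\in A\setminus\{0,1\}$ there are $p_a,q_a\in\omega$ with $d^{p_a}a=0$ and $\hat{d}^{q_a}a=1$; (c) $\mathcal{F}_t(A)=\{A,\{1\}\}$ and $\mathcal{I}_t(A)=\{A,\{0\}\}$. Moreover, if $\mathcal{A}$ is finite, (a), (b), (c) are equivalent to (d): $A^d=\{0,1\}$.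
   Context: A $\mathbf{tDL}$-algebra is a bounded distributive lattice $\langle A,\wedge,\vee,0,1\rangle$ with unary operators $\mathbf{G},\mathbf{H},\mathbf{F},\mathbf{P}$ such that for all $x,y$: $\mathbf{G}1=\mathbf{H}1=1$; $\mathbf{G},\mathbf{H}$ preserve $\wedge$; $x\le\mathbf{G}\mathbf{P}x$, $x\le\mathbf{H}\mathbf{F}x$; $\mathbf{G}(x\vee y)\le\mathbf{G}x\vee\mathbf{F}y$, $\mathbf{H}(x\vee y)\le\mathbf{H}x\vee\mathbf{P}y$; $\mathbf{F}0=\mathbf{P}0=0$; $\mathbf{F},\mathbf{P}$ preserve $\vee$; $\mathbf{P}\mathbf{G}x\le x$, $\mathbf{F}\mathbf{H}x\le x$; $\mathbf{G}x\wedge\mathbf{F}y\le\mathbf{F}(x\wedge y)$, $\mathbf{H}x\wedge\mathbf{P}y\le\mathbf{P}(x\wedge y)$. Define $dx=\mathbf{G}x\wedge x\wedge\mathbf{H}x$ and $\hat{d}x=\mathbf{F}x\vee x\vee\mathbf{P}x$, with $d^0x=x$, $d^{n+1}x=d(d^nx)$, and similarly $\hat{d}^n$. $A^d=\{x\in A:x=dx\}$. $\mathcal{F}_t(A)$ is the set of tense filters (lattice filters $S$ with $\mathbf{G}x,\mathbf{H}x\in S$ for all $x\in S$), and $\mathcal{I}_t(A)$ the set of tense ideals (lattice ideals $I$ with $\mathbf{F}x,\mathbf{P}x\in I$ for all $x\in I$). -}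

module Defs where

open import Level using (Level; _⊔_) renaming (suc to lsuc)
open import Data.Nat using (ℕ; zero; suc)
open import Data.Fin using (Fin)
open import Data.Vec using (Vec; []; _∷_; lookup)
open import Data.Product using (Σ; ∃; ∃-syntax; _×_; _,_)
open import Data.Sum using (_⊎_)
open import Relation.Nullary using (¬_)
open import Relation.Unary using (Pred; _≐_; ∅; ｛_｝; U)
open import Relation.Binary.PropositionalEquality using (_≡_; _≢_)
import Algebra.Lattice.Structures as LS
open import Function.Bundles using (_⇔_; _↔_)

record TDLAlgebra (c : Level) : Set (lsuc c) where
  infixr 7 _∧_
  infixr 6 _∨_
  infix 4 _≤_
  field
    Carrier : Set c
    _∧_ _∨_ : Carrier → Carrier → Carrier
    𝟘 𝟙 : Carrier
    isDistributiveLattice : LS.IsDistributiveLattice {A = Carrier} _≡_ _∨_ _∧_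
    𝟘-identity : ∀ x → 𝟘 ∨ x ≡ x
    𝟙-identity : ∀ x → 𝟙 ∧ x ≡ x

  _≤_ : Carrier → Carrier → Set c
  x ≤ y = x ∧ y ≡ x

  field
    G H F P : Carrier → Carrier
    G𝟙 : G 𝟙 ≡ 𝟙
    H𝟙 : H 𝟙 ≡ 𝟙
    G-∧ : ∀ x y → G (x ∧ y) ≡ G x ∧ G y
    H-∧ : ∀ x y → H (x ∧ y) ≡ H x ∧ H y
    x≤GPx : ∀ x → x ≤ G (P x)
    x≤HFx : ∀ x → x ≤ H (F x)
    G-∨ : ∀ x y → G (x ∨ y) ≤ G x ∨ F y
    H-∨ : ∀ x y → H (x ∨ y) ≤ H x ∨ P y
    F𝟘 : F 𝟘 ≡ 𝟘
    P𝟘 : P 𝟘 ≡ 𝟘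
    F-∨ : ∀ x y → F (x ∨ y) ≡ F x ∨ F y
    P-∨ : ∀ x y → P (x ∨ y) ≡ P x ∨ P y
    PGx≤x : ∀ x → P (G x) ≤ x
    FHx≤x : ∀ x → F (H x) ≤ x
    G-F : ∀ x y → G x ∧ F y ≤ F (x ∧ y)
    H-P : ∀ x y → H x ∧ P y ≤ P (x ∧ y)

  d : Carrier → Carrier
  d x = G x ∧ x ∧ H x

  d̂ : Carrier → Carrier
  d̂ x = F x ∨ x ∨ P x

  d^ : ℕ → Carrier → Carrier
  d^ zero x = x
  d^ (suc n) x = d (d^ n x)

  d̂^ : ℕ → Carrier → Carrier
  d̂^ zero x = x
  d̂^ (suc n) x = d̂ (d̂^ n x)

  ⋀ : ∀ {n} → Vec Carrier (suc n) → Carrier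
  ⋀ (x ∷ []) = x
  ⋀ (x ∷ y ∷ xs) = x ∧ ⋀ (y ∷ xs)

  ⋁ : ∀ {n} → Vec Carrier (suc n) → Carrier
  ⋁ (x ∷ []) = x
  ⋁ (x ∷ y ∷ xs) = x ∨ ⋁ (y ∷ xs)

  record IsFilter (S : Pred Carrier c) : Set c where
    field
      𝟙∈ : S 𝟙
      up : ∀ {x y} → S x → x ≤ y → S y
      ∧-closed : ∀ {x y} → S x → S y → S (x ∧ y)

  record IsIdeal (I : Pred Carrier c) : Set c where
    field
      𝟘∈ : I 𝟘
      down : ∀ {x y} → I y → x ≤ y → I x
      ∨-closed : ∀ {x y} → I x → I y → I (x ∨ y)

  record IsTenseFilter (S : Pred Carrier c) : Set c where
    field
      isFilter : IsFilter S
      G-closed : ∀ {x} → S x → S (G x)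
      H-closed : ∀ {x} → S x → S (H x)

  record IsTenseIdeal (I : Pred Carrier c) : Set c where
    field
      isIdeal : IsIdeal I
      F-closed : ∀ {x} → I x → I (F x)
      P-closed : ∀ {x} → I x → I (P x)

  CondA : Set (lsuc c)
  CondA = (X : Pred Carrier c) → ¬ (X ≐ ∅) → ¬ (X ≐ ｛ 𝟘 ｝) → ¬ (X ≐ ｛ 𝟙 ｝) →
    (a : Carrier) →
    Σ ℕ λ n → Σ (Vec Carrier (suc n)) λ xs →
    Σ ℕ λ m → Σ (Vec Carrier (suc m)) λ ys →
    Σ ℕ λ p → Σ ℕ λ q →
      (∀ i → X (lookup xs i)) × (∀ j → X (lookup ys j)) ×
      d^ p (⋀ xs) ≤ a × a ≤ d̂^ q (⋁ ys)

  CondB : Set c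
  CondB = (a : Carrier) → a ≢ 𝟘 → a ≢ 𝟙 →
    Σ ℕ λ p → Σ ℕ λ q → d^ p a ≡ 𝟘 × d̂^ q a ≡ 𝟙

  CondC : Set (lsuc c)
  CondC = ((S : Pred Carrier c) → IsTenseFilter S ⇔ (S ≐ U ⊎ S ≐ ｛ 𝟙 ｝))
        × ((I : Pred Carrier c) → IsTenseIdeal I ⇔ (I ≐ U ⊎ I ≐ ｛ 𝟘 ｝))

  CondD : Set c
  CondD = (x : Carrier) → (x ≡ d x) ⇔ (x ≡ 𝟘 ⊎ x ≡ 𝟙)

  IsFinite : Set c
  IsFinite = Σ ℕ λ n → Carrier ↔ Fin n

{-# OPTIONS --safe #-}
-- Every tense filter is closed under d and every tense ideal under d̂, and the tense
-- filter (ideal) generated by a consists of the x with d^p a ≤ x (x ≤ d̂^q a) for some p (q).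
-- Hence (b) says exactly that every a ∉ {0,1} generates only the improper tense filter and
-- ideal, which is (c). Condition (a) for X = {a} gives (b); conversely an element of X other
-- than 1 and one other than 0 witness (a). In the finite case the decreasing d-iterates and
-- the increasing d̂-iterates of a stabilise, and by the adjunctions P ⊣ G and F ⊣ H every
-- d̂-fixed point is d-fixed, so (d) forces the limits to be 0 and 1.
module Submission where

open import Defs
open import Level using (Level)
open import Axiom.ExcludedMiddle using (ExcludedMiddle)
open import Algebra.Lattice.Bundles using (Lattice)
open import Algebra.Lattice.Structures using (module IsDistributiveLattice)
import Algebra.Lattice.Properties.Lattice as LatticeProperties
import Relation.Binary.Lattice as Order
open import Data.Nat using (ℕ; zero; suc; _<_; _⊔_; z≤n; _≤′_; ≤′-refl; ≤′-step)
  renaming (_≤_ to _≤ℕ_)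
open import Data.Nat.Properties using (≤⇒≤′; m≤m⊔n; m≤n⊔m; n<1+n)
open import Data.Fin using (Fin; toℕ)
open import Data.Fin.Properties using (pigeonhole)
open import Data.Vec using (Vec; []; _∷_; lookup)
open import Data.Product using (_×_; _,_; proj₁; proj₂; ∃; ∃-syntax; ∃₂)
open import Data.Sum using (_⊎_; inj₁; inj₂; [_,_]′)
open import Data.Unit using (tt)
open import Function using (_∘_)
open import Function.Bundles using (_⇔_; mk⇔; _↔_; module Equivalence; module Injection)
open import Function.Properties.Inverse using (↔⇒↣)
open import Relation.Nullary using (¬_; yes; no; contradiction)
open import Relation.Nullary.Decidable using (decidable-stable)
open import Relation.Unary using (Pred; _≐_; ∅; ｛_｝; U)
open import Relation.Binary.PropositionalEquality
  using (_≡_; _≢_; refl; sym; trans; cong; cong₂; subst)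

↔Fin⇒repeats : ∀ {a} {A : Set a} {n} → A ↔ Fin n → (s : ℕ → A) →
               ∃₂ λ i j → i < j × s i ≡ s j
↔Fin⇒repeats {n = n} A↔Fin s =
  let i , j , i<j , eq = pigeonhole (n<1+n n) (to ∘ s ∘ toℕ)
  in toℕ i , toℕ j , i<j , injective eq
  where open Injection (↔⇒↣ A↔Fin)

module TDLProperties {c : Level} (𝒜 : TDLAlgebra c) where
  open TDLAlgebra 𝒜

  lattice : Lattice c c
  lattice = record { isLattice = IsDistributiveLattice.isLattice isDistributiveLattice }

  open Lattice lattice using (∧-comm; ∧-absorbs-∨)
  open LatticeProperties lattice using (∧-idem; ∨-idem; ∨-∧-orderTheoreticLattice)

  -- The library orders a lattice by x ≡ x ∧ y, the mirror image of _≤_.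
  private module ⊑ = Order.Lattice ∨-∧-orderTheoreticLattice

  ≤-refl : ∀ {x} → x ≤ x
  ≤-refl = sym ⊑.refl

  ≤-trans : ∀ {x y z} → x ≤ y → y ≤ z → x ≤ z
  ≤-trans x≤y y≤z = sym (⊑.trans (sym x≤y) (sym y≤z))

  ≤-antisym : ∀ {x y} → x ≤ y → y ≤ x → x ≡ y
  ≤-antisym x≤y y≤x = ⊑.antisym (sym x≤y) (sym y≤x)

  x∧y≤x : ∀ x y → x ∧ y ≤ x
  x∧y≤x x y = sym (⊑.x∧y≤x x y)

  x∧y≤y : ∀ x y → x ∧ y ≤ y
  x∧y≤y x y = sym (⊑.x∧y≤y x y)

  ∧-greatest : ∀ {x y z} → x ≤ y → x ≤ z → x ≤ y ∧ z
  ∧-greatest x≤y x≤z = sym (⊑.∧-greatest (sym x≤y) (sym x≤z))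

  x≤x∨y : ∀ x y → x ≤ x ∨ y
  x≤x∨y x y = sym (⊑.x≤x∨y x y)

  y≤x∨y : ∀ x y → y ≤ x ∨ y
  y≤x∨y x y = sym (⊑.y≤x∨y x y)

  ∨-least : ∀ {x y z} → x ≤ z → y ≤ z → x ∨ y ≤ z
  ∨-least x≤z y≤z = sym (⊑.∨-least (sym x≤z) (sym y≤z))

  x≤y⇒x∨y≡y : ∀ {x y} → x ≤ y → x ∨ y ≡ y
  x≤y⇒x∨y≡y {x} {y} x≤y = ≤-antisym (∨-least x≤y ≤-refl) (y≤x∨y x y)

  𝟘≤x : ∀ x → 𝟘 ≤ x
  𝟘≤x x = trans (cong (𝟘 ∧_) (sym (𝟘-identity x))) (∧-absorbs-∨ 𝟘 x)

  x≤𝟙 : ∀ x → x ≤ 𝟙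
  x≤𝟙 x = trans (∧-comm x 𝟙) (𝟙-identity x)

  ≤𝟘⇒≡𝟘 : ∀ {x} → x ≤ 𝟘 → x ≡ 𝟘
  ≤𝟘⇒≡𝟘 {x} x≤𝟘 = ≤-antisym x≤𝟘 (𝟘≤x x)

  𝟙≤⇒≡𝟙 : ∀ {x} → 𝟙 ≤ x → x ≡ 𝟙
  𝟙≤⇒≡𝟙 {x} 𝟙≤x = ≤-antisym (x≤𝟙 x) 𝟙≤x

  ∧-homo⇒mono : (f : Carrier → Carrier) → (∀ x y → f (x ∧ y) ≡ f x ∧ f y) →
                ∀ {x y} → x ≤ y → f x ≤ f y
  ∧-homo⇒mono f f-∧ {x} {y} x≤y = trans (sym (f-∧ x y)) (cong f x≤y)

  ∨-homo⇒mono : (f : Carrier → Carrier) → (∀ x y → f (x ∨ y) ≡ f x ∨ f y) →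
                ∀ {x y} → x ≤ y → f x ≤ f y
  ∨-homo⇒mono f f-∨ {x} {y} x≤y =
    subst (f x ≤_) (trans (sym (f-∨ x y)) (cong f (x≤y⇒x∨y≡y x≤y))) (x≤x∨y (f x) (f y))

  G-mono : ∀ {x y} → x ≤ y → G x ≤ G y
  G-mono = ∧-homo⇒mono G G-∧

  H-mono : ∀ {x y} → x ≤ y → H x ≤ H y
  H-mono = ∧-homo⇒mono H H-∧

  F-mono : ∀ {x y} → x ≤ y → F x ≤ F y
  F-mono = ∨-homo⇒mono F F-∨

  P-mono : ∀ {x y} → x ≤ y → P x ≤ P y
  P-mono = ∨-homo⇒mono P P-∨

  ⋀-constant : ∀ {a n} (xs : Vec Carrier (suc n)) → (∀ i → a ≡ lookup xs i) → ⋀ xs ≡ a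
  ⋀-constant (x ∷ []) xs≡a = sym (xs≡a Fin.zero)
  ⋀-constant {a} (x ∷ y ∷ xs) xs≡a =
    trans (cong₂ _∧_ (sym (xs≡a Fin.zero)) (⋀-constant (y ∷ xs) (xs≡a ∘ Fin.suc))) (∧-idem a)

  ⋁-constant : ∀ {a n} (xs : Vec Carrier (suc n)) → (∀ i → a ≡ lookup xs i) → ⋁ xs ≡ a
  ⋁-constant (x ∷ []) xs≡a = sym (xs≡a Fin.zero)
  ⋁-constant {a} (x ∷ y ∷ xs) xs≡a =
    trans (cong₂ _∨_ (sym (xs≡a Fin.zero)) (⋁-constant (y ∷ xs) (xs≡a ∘ Fin.suc))) (∨-idem a)

  d≤G : ∀ x → d x ≤ G x
  d≤G x = x∧y≤x (G x) (x ∧ H x)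

  d≤H : ∀ x → d x ≤ H x
  d≤H x = ≤-trans (x∧y≤y (G x) (x ∧ H x)) (x∧y≤y x (H x))

  d-deflationary : ∀ x → d x ≤ x
  d-deflationary x = ≤-trans (x∧y≤y (G x) (x ∧ H x)) (x∧y≤x x (H x))

  F≤d̂ : ∀ x → F x ≤ d̂ x
  F≤d̂ x = x≤x∨y (F x) (x ∨ P x)

  P≤d̂ : ∀ x → P x ≤ d̂ x
  P≤d̂ x = ≤-trans (y≤x∨y x (P x)) (y≤x∨y (F x) (x ∨ P x))

  d̂-inflationary : ∀ x → x ≤ d̂ x
  d̂-inflationary x = ≤-trans (x≤x∨y x (P x)) (y≤x∨y (F x) (x ∨ P x))

  d𝟘≡𝟘 : d 𝟘 ≡ 𝟘
  d𝟘≡𝟘 = ≤𝟘⇒≡𝟘 (d-deflationary 𝟘)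

  d𝟙≡𝟙 : d 𝟙 ≡ 𝟙
  d𝟙≡𝟙 = trans (cong₂ (λ g h → g ∧ 𝟙 ∧ h) G𝟙 H𝟙)
                (trans (cong (𝟙 ∧_) (𝟙-identity 𝟙)) (𝟙-identity 𝟙))

  -- P z ≤ z gives z ≤ G (P z) ≤ G z, and dually F z ≤ z gives z ≤ H z.
  d̂-fixed⇒d-fixed : ∀ {z} → d̂ z ≡ z → z ≡ d z
  d̂-fixed⇒d-fixed {z} d̂z≡z =
    ≤-antisym (∧-greatest z≤Gz (∧-greatest ≤-refl z≤Hz)) (d-deflationary z)
    where
    z≤Gz : z ≤ G z
    z≤Gz = ≤-trans (x≤GPx z) (G-mono (subst (P z ≤_) d̂z≡z (P≤d̂ z)))
    z≤Hz : z ≤ H z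
    z≤Hz = ≤-trans (x≤HFx z) (H-mono (subst (F z ≤_) d̂z≡z (F≤d̂ z)))

  antitone-by-step : (s : ℕ → Carrier) → (∀ n → s (suc n) ≤ s n) →
                     ∀ {m n} → m ≤ℕ n → s n ≤ s m
  antitone-by-step s step m≤n = go (≤⇒≤′ m≤n)
    where
    go : ∀ {m n} → m ≤′ n → s n ≤ s m
    go ≤′-refl = ≤-refl
    go (≤′-step m≤′n) = ≤-trans (step _) (go m≤′n)

  monotone-by-step : (s : ℕ → Carrier) → (∀ n → s n ≤ s (suc n)) →
                     ∀ {m n} → m ≤ℕ n → s m ≤ s n
  monotone-by-step s step m≤n = go (≤⇒≤′ m≤n)
    where
    go : ∀ {m n} → m ≤′ n → s m ≤ s n
    go ≤′-refl = ≤-refl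
    go (≤′-step m≤′n) = ≤-trans (go m≤′n) (step _)

  antitone-repeat⇒stable : (s : ℕ → Carrier) → (∀ n → s (suc n) ≤ s n) →
                           ∀ {i j} → i < j → s i ≡ s j → s (suc i) ≡ s i
  antitone-repeat⇒stable s step i<j si≡sj =
    ≤-antisym (step _) (subst (_≤ s (suc _)) (sym si≡sj) (antitone-by-step s step i<j))

  monotone-repeat⇒stable : (s : ℕ → Carrier) → (∀ n → s n ≤ s (suc n)) →
                           ∀ {i j} → i < j → s i ≡ s j → s (suc i) ≡ s i
  monotone-repeat⇒stable s step i<j si≡sj =
    ≤-antisym (subst (s (suc _) ≤_) (sym si≡sj) (monotone-by-step s step i<j)) (step _)

  d^-antitone : ∀ a {m n} → m ≤ℕ n → d^ n a ≤ d^ m a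
  d^-antitone a = antitone-by-step (λ n → d^ n a) (λ n → d-deflationary (d^ n a))

  d̂^-monotone : ∀ a {m n} → m ≤ℕ n → d̂^ m a ≤ d̂^ n a
  d̂^-monotone a = monotone-by-step (λ n → d̂^ n a) (λ n → d̂-inflationary (d̂^ n a))

  d^-deflationary : ∀ a p → d^ p a ≤ a
  d^-deflationary a p = d^-antitone a (z≤n {p})

  d̂^-inflationary : ∀ a q → a ≤ d̂^ q a
  d̂^-inflationary a q = d̂^-monotone a (z≤n {q})

  d-fixed⇒d^-fixed : ∀ {x} → x ≡ d x → ∀ p → d^ p x ≡ x
  d-fixed⇒d^-fixed x≡dx zero = refl
  d-fixed⇒d^-fixed x≡dx (suc p) = trans (cong d (d-fixed⇒d^-fixed x≡dx p)) (sym x≡dx)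

  finite⇒d^-reaches-d-fixed : IsFinite → ∀ a → ∃[ p ] d^ p a ≡ d (d^ p a)
  finite⇒d^-reaches-d-fixed (_ , A↔Fin) a =
    let i , _ , i<j , eq = ↔Fin⇒repeats A↔Fin (λ n → d^ n a)
    in i , sym (antitone-repeat⇒stable (λ n → d^ n a) (λ n → d-deflationary (d^ n a)) i<j eq)

  finite⇒d̂^-reaches-d̂-fixed : IsFinite → ∀ a → ∃[ q ] d̂ (d̂^ q a) ≡ d̂^ q a
  finite⇒d̂^-reaches-d̂-fixed (_ , A↔Fin) a =
    let i , _ , i<j , eq = ↔Fin⇒repeats A↔Fin (λ n → d̂^ n a)
    in i , monotone-repeat⇒stable (λ n → d̂^ n a) (λ n → d̂-inflationary (d̂^ n a)) i<j eq

  d-closed : ∀ {S} → IsTenseFilter S → ∀ {x} → S x → S (d x)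
  d-closed T Sx = ∧-closed (G-closed Sx) (∧-closed Sx (H-closed Sx))
    where
    open IsTenseFilter T
    open IsFilter isFilter

  d^-closed : ∀ {S} → IsTenseFilter S → ∀ p {x} → S x → S (d^ p x)
  d^-closed T zero Sx = Sx
  d^-closed T (suc p) Sx = d-closed T (d^-closed T p Sx)

  d̂-closed : ∀ {I} → IsTenseIdeal I → ∀ {x} → I x → I (d̂ x)
  d̂-closed T Ix = ∨-closed (F-closed Ix) (∨-closed Ix (P-closed Ix))
    where
    open IsTenseIdeal T
    open IsIdeal isIdeal

  d̂^-closed : ∀ {I} → IsTenseIdeal I → ∀ q {x} → I x → I (d̂^ q x)
  d̂^-closed T zero Ix = Ix
  d̂^-closed T (suc q) Ix = d̂-closed T (d̂^-closed T q Ix)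

  generatedTenseFilter : Carrier → Pred Carrier c
  generatedTenseFilter a x = ∃[ p ] d^ p a ≤ x

  generatedTenseIdeal : Carrier → Pred Carrier c
  generatedTenseIdeal a x = ∃[ q ] x ≤ d̂^ q a

  generatedTenseFilter-isTenseFilter : ∀ a → IsTenseFilter (generatedTenseFilter a)
  generatedTenseFilter-isTenseFilter a = record
    { isFilter = record
      { 𝟙∈ = 0 , x≤𝟙 a
      ; up = λ { (p , d^pa≤x) x≤y → p , ≤-trans d^pa≤x x≤y }
      ; ∧-closed = λ { (p , d^pa≤x) (q , d^qa≤y) →
          p ⊔ q , ∧-greatest (≤-trans (d^-antitone a (m≤m⊔n p q)) d^pa≤x)
                             (≤-trans (d^-antitone a (m≤n⊔m p q)) d^qa≤y) }
      }
    ; G-closed = λ { (p , d^pa≤x) → suc p , ≤-trans (d≤G (d^ p a)) (G-mono d^pa≤x) }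
    ; H-closed = λ { (p , d^pa≤x) → suc p , ≤-trans (d≤H (d^ p a)) (H-mono d^pa≤x) }
    }

  generatedTenseIdeal-isTenseIdeal : ∀ a → IsTenseIdeal (generatedTenseIdeal a)
  generatedTenseIdeal-isTenseIdeal a = record
    { isIdeal = record
      { 𝟘∈ = 0 , 𝟘≤x a
      ; down = λ { (q , y≤d̂^qa) x≤y → q , ≤-trans x≤y y≤d̂^qa }
      ; ∨-closed = λ { (p , x≤d̂^pa) (q , y≤d̂^qa) →
          p ⊔ q , ∨-least (≤-trans x≤d̂^pa (d̂^-monotone a (m≤m⊔n p q)))
                          (≤-trans y≤d̂^qa (d̂^-monotone a (m≤n⊔m p q))) }
      }
    ; F-closed = λ { (q , x≤d̂^qa) → suc q , ≤-trans (F-mono x≤d̂^qa) (F≤d̂ (d̂^ q a)) }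
    ; P-closed = λ { (q , x≤d̂^qa) → suc q , ≤-trans (P-mono x≤d̂^qa) (P≤d̂ (d̂^ q a)) }
    }

  ≐U⇒isTenseFilter : ∀ {S} → S ≐ U → IsTenseFilter S
  ≐U⇒isTenseFilter (_ , U⊆S) = record
    { isFilter = record { 𝟙∈ = U⊆S tt ; up = λ _ _ → U⊆S tt ; ∧-closed = λ _ _ → U⊆S tt }
    ; G-closed = λ _ → U⊆S tt
    ; H-closed = λ _ → U⊆S tt
    }

  ≐U⇒isTenseIdeal : ∀ {I} → I ≐ U → IsTenseIdeal I
  ≐U⇒isTenseIdeal (_ , U⊆I) = record
    { isIdeal = record { 𝟘∈ = U⊆I tt ; down = λ _ _ → U⊆I tt ; ∨-closed = λ _ _ → U⊆I tt }
    ; F-closed = λ _ → U⊆I tt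
    ; P-closed = λ _ → U⊆I tt
    }

  ≐｛𝟙｝⇒isTenseFilter : ∀ {S} → S ≐ ｛ 𝟙 ｝ → IsTenseFilter S
  ≐｛𝟙｝⇒isTenseFilter (S⊆𝟙 , 𝟙⊆S) = record
    { isFilter = record
      { 𝟙∈ = 𝟙⊆S refl
      ; up = λ Sx x≤y → 𝟙⊆S (sym (𝟙≤⇒≡𝟙 (subst (_≤ _) (sym (S⊆𝟙 Sx)) x≤y)))
      ; ∧-closed = λ Sx Sy → 𝟙⊆S (trans (sym (𝟙-identity 𝟙)) (cong₂ _∧_ (S⊆𝟙 Sx) (S⊆𝟙 Sy)))
      }
    ; G-closed = λ Sx → 𝟙⊆S (trans (sym G𝟙) (cong G (S⊆𝟙 Sx)))
    ; H-closed = λ Sx → 𝟙⊆S (trans (sym H𝟙) (cong H (S⊆𝟙 Sx)))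
    }

  ≐｛𝟘｝⇒isTenseIdeal : ∀ {I} → I ≐ ｛ 𝟘 ｝ → IsTenseIdeal I
  ≐｛𝟘｝⇒isTenseIdeal (I⊆𝟘 , 𝟘⊆I) = record
    { isIdeal = record
      { 𝟘∈ = 𝟘⊆I refl
      ; down = λ Iy x≤y → 𝟘⊆I (sym (≤𝟘⇒≡𝟘 (subst (_ ≤_) (sym (I⊆𝟘 Iy)) x≤y)))
      ; ∨-closed = λ Ix Iy → 𝟘⊆I (trans (sym (𝟘-identity 𝟘)) (cong₂ _∨_ (I⊆𝟘 Ix) (I⊆𝟘 Iy)))
      }
    ; F-closed = λ Ix → 𝟘⊆I (trans (sym F𝟘) (cong F (I⊆𝟘 Ix)))
    ; P-closed = λ Ix → 𝟘⊆I (trans (sym P𝟘) (cong P (I⊆𝟘 Ix)))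
    }

  filter∋𝟘⇒≐U : ∀ {S} → IsFilter S → S 𝟘 → S ≐ U
  filter∋𝟘⇒≐U S-filter S𝟘 = (λ _ → tt) , λ _ → IsFilter.up S-filter S𝟘 (𝟘≤x _)

  ideal∋𝟙⇒≐U : ∀ {I} → IsIdeal I → I 𝟙 → I ≐ U
  ideal∋𝟙⇒≐U I-ideal I𝟙 = (λ _ → tt) , λ _ → IsIdeal.down I-ideal I𝟙 (x≤𝟙 _)

  filter⊆｛𝟙｝⇒≐｛𝟙｝ : ∀ {S} → IsFilter S → (∀ {x} → S x → x ≡ 𝟙) → S ≐ ｛ 𝟙 ｝
  filter⊆｛𝟙｝⇒≐｛𝟙｝ S-filter S⊆𝟙 = (λ Sx → sym (S⊆𝟙 Sx)) , λ { refl → IsFilter.𝟙∈ S-filter }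

  ideal⊆｛𝟘｝⇒≐｛𝟘｝ : ∀ {I} → IsIdeal I → (∀ {x} → I x → x ≡ 𝟘) → I ≐ ｛ 𝟘 ｝
  ideal⊆｛𝟘｝⇒≐｛𝟘｝ I-ideal I⊆𝟘 = (λ Ix → sym (I⊆𝟘 Ix)) , λ { refl → IsIdeal.𝟘∈ I-ideal }

  CondA-singleton : CondA → ∀ {a} → a ≢ 𝟘 → a ≢ 𝟙 → ∀ b → ∃₂ λ p q → d^ p a ≤ b × b ≤ d̂^ q a
  CondA-singleton A {a} a≢𝟘 a≢𝟙 b =
    let _ , xs , _ , ys , p , q , xs≡a , ys≡a , d^p⋀xs≤b , b≤d̂^q⋁ys =
          A ｛ a ｝ (λ eq → proj₁ eq refl) (λ eq → a≢𝟘 (sym (proj₁ eq refl)))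
            (λ eq → a≢𝟙 (sym (proj₁ eq refl))) b
    in p , q , subst (λ x → d^ p x ≤ b) (⋀-constant xs xs≡a) d^p⋀xs≤b
             , subst (λ y → b ≤ d̂^ q y) (⋁-constant ys ys≡a) b≤d̂^q⋁ys

  A⇒B : CondA → CondB
  A⇒B A a a≢𝟘 a≢𝟙 =
    let p , _ , d^pa≤𝟘 , _ = CondA-singleton A a≢𝟘 a≢𝟙 𝟘
        _ , q , _ , 𝟙≤d̂^qa = CondA-singleton A a≢𝟘 a≢𝟙 𝟙
    in p , q , ≤𝟘⇒≡𝟘 d^pa≤𝟘 , 𝟙≤⇒≡𝟙 𝟙≤d̂^qa

  CondC⇒d^≡𝟘 : CondC → ∀ {a} → a ≢ 𝟙 → ∃[ p ] d^ p a ≡ 𝟘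
  CondC⇒d^≡𝟘 (C , _) {a} a≢𝟙
    with Equivalence.to (C (generatedTenseFilter a)) (generatedTenseFilter-isTenseFilter a)
  ... | inj₁ ≐U = let p , d^pa≤𝟘 = proj₂ ≐U tt in p , ≤𝟘⇒≡𝟘 d^pa≤𝟘
  ... | inj₂ ≐｛𝟙｝ = contradiction (sym (proj₁ ≐｛𝟙｝ (0 , ≤-refl))) a≢𝟙

  CondC⇒d̂^≡𝟙 : CondC → ∀ {a} → a ≢ 𝟘 → ∃[ q ] d̂^ q a ≡ 𝟙
  CondC⇒d̂^≡𝟙 (_ , C) {a} a≢𝟘
    with Equivalence.to (C (generatedTenseIdeal a)) (generatedTenseIdeal-isTenseIdeal a)
  ... | inj₁ ≐U = let q , 𝟙≤d̂^qa = proj₂ ≐U tt in q , 𝟙≤⇒≡𝟙 𝟙≤d̂^qa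
  ... | inj₂ ≐｛𝟘｝ = contradiction (sym (proj₁ ≐｛𝟘｝ (0 , ≤-refl))) a≢𝟘

  C⇒B : CondC → CondB
  C⇒B C a a≢𝟘 a≢𝟙 =
    let p , d^pa≡𝟘 = CondC⇒d^≡𝟘 C a≢𝟙
        q , d̂^qa≡𝟙 = CondC⇒d̂^≡𝟙 C a≢𝟘
    in p , q , d^pa≡𝟘 , d̂^qa≡𝟙

  CondD⇒d-fixed≢𝟙⇒≡𝟘 : CondD → ∀ {x} → x ≡ d x → x ≢ 𝟙 → x ≡ 𝟘
  CondD⇒d-fixed≢𝟙⇒≡𝟘 D x≡dx x≢𝟙 =
    [ (λ x≡𝟘 → x≡𝟘) , (λ x≡𝟙 → contradiction x≡𝟙 x≢𝟙) ]′ (Equivalence.to (D _) x≡dx)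

  CondD⇒d-fixed≢𝟘⇒≡𝟙 : CondD → ∀ {x} → x ≡ d x → x ≢ 𝟘 → x ≡ 𝟙
  CondD⇒d-fixed≢𝟘⇒≡𝟙 D x≡dx x≢𝟘 =
    [ (λ x≡𝟘 → contradiction x≡𝟘 x≢𝟘) , (λ x≡𝟙 → x≡𝟙) ]′ (Equivalence.to (D _) x≡dx)

  D⇒B : IsFinite → CondD → CondB
  D⇒B fin D a a≢𝟘 a≢𝟙 =
    let p , d^pa-fixed = finite⇒d^-reaches-d-fixed fin a
        q , d̂^qa-fixed = finite⇒d̂^-reaches-d̂-fixed fin a
    in p , q
     , CondD⇒d-fixed≢𝟙⇒≡𝟘 D d^pa-fixed
         (λ d^pa≡𝟙 → a≢𝟙 (𝟙≤⇒≡𝟙 (subst (_≤ a) d^pa≡𝟙 (d^-deflationary a p))))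
     , CondD⇒d-fixed≢𝟘⇒≡𝟙 D (d̂-fixed⇒d-fixed d̂^qa-fixed)
         (λ d̂^qa≡𝟘 → a≢𝟘 (≤𝟘⇒≡𝟘 (subst (a ≤_) d̂^qa≡𝟘 (d̂^-inflationary a q))))

module Classical {c : Level} (𝒜 : TDLAlgebra c) (em : ExcludedMiddle c) where
  open TDLAlgebra 𝒜
  open TDLProperties 𝒜

  ¬≐∅⇒∃ : ∀ {X : Pred Carrier c} → ¬ (X ≐ ∅) → ∃ X
  ¬≐∅⇒∃ X≉∅ = decidable-stable em (λ ¬∃X → X≉∅ ((λ Xx → ¬∃X (_ , Xx)) , λ ()))

  ∃≢⊎⊆｛｝ : (X : Pred Carrier c) (e : Carrier) → (∃ λ x → X x × x ≢ e) ⊎ (∀ {x} → X x → x ≡ e)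
  ∃≢⊎⊆｛｝ X e with em {∃ λ x → X x × x ≢ e}
  ... | yes ∃≢ = inj₁ ∃≢
  ... | no ¬∃≢ = inj₂ λ Xx → decidable-stable em (λ x≢e → ¬∃≢ (_ , Xx , x≢e))

  ¬≐｛｝⇒∃≢ : ∀ {X : Pred Carrier c} {e} → ∃ X → ¬ (X ≐ ｛ e ｝) → ∃ λ x → X x × x ≢ e
  ¬≐｛｝⇒∃≢ {X} {e} (x , Xx) X≉｛e｝ with ∃≢⊎⊆｛｝ X e
  ... | inj₁ ∃≢ = ∃≢
  ... | inj₂ X⊆e =
    contradiction ((λ {_} Xy → sym (X⊆e Xy)) , λ { refl → subst X (X⊆e Xx) Xx }) X≉｛e｝

  CondB⇒d^≡𝟘 : CondB → ∀ {a} → a ≢ 𝟙 → ∃[ p ] d^ p a ≡ 𝟘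
  CondB⇒d^≡𝟘 B {a} a≢𝟙 with em {a ≡ 𝟘}
  ... | yes a≡𝟘 = 0 , a≡𝟘
  ... | no a≢𝟘 = let p , _ , d^pa≡𝟘 , _ = B a a≢𝟘 a≢𝟙 in p , d^pa≡𝟘

  CondB⇒d̂^≡𝟙 : CondB → ∀ {a} → a ≢ 𝟘 → ∃[ q ] d̂^ q a ≡ 𝟙
  CondB⇒d̂^≡𝟙 B {a} a≢𝟘 with em {a ≡ 𝟙}
  ... | yes a≡𝟙 = 0 , a≡𝟙
  ... | no a≢𝟙 = let _ , q , _ , d̂^qa≡𝟙 = B a a≢𝟘 a≢𝟙 in q , d̂^qa≡𝟙

  B⇒A : CondB → CondA
  B⇒A B X X≉∅ X≉｛𝟘｝ X≉｛𝟙｝ a =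
    let x , Xx , x≢𝟘 = ¬≐｛｝⇒∃≢ (¬≐∅⇒∃ X≉∅) X≉｛𝟘｝
        y , Xy , y≢𝟙 = ¬≐｛｝⇒∃≢ (¬≐∅⇒∃ X≉∅) X≉｛𝟙｝
        p , d^py≡𝟘 = CondB⇒d^≡𝟘 B y≢𝟙
        q , d̂^qx≡𝟙 = CondB⇒d̂^≡𝟙 B x≢𝟘
    in 0 , y ∷ [] , 0 , x ∷ [] , p , q , (λ { Fin.zero → Xy }) , (λ { Fin.zero → Xx })
     , subst (_≤ a) (sym d^py≡𝟘) (𝟘≤x a) , subst (a ≤_) (sym d̂^qx≡𝟙) (x≤𝟙 a)

  B⇒tenseFilter-trivial : CondB → ∀ {S} → IsTenseFilter S → S ≐ U ⊎ S ≐ ｛ 𝟙 ｝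
  B⇒tenseFilter-trivial B {S} T with ∃≢⊎⊆｛｝ S 𝟙
  ... | inj₁ (x , Sx , x≢𝟙) =
    let p , d^px≡𝟘 = CondB⇒d^≡𝟘 B x≢𝟙
    in inj₁ (filter∋𝟘⇒≐U (IsTenseFilter.isFilter T) (subst S d^px≡𝟘 (d^-closed T p Sx)))
  ... | inj₂ S⊆𝟙 = inj₂ (filter⊆｛𝟙｝⇒≐｛𝟙｝ (IsTenseFilter.isFilter T) S⊆𝟙)

  B⇒tenseIdeal-trivial : CondB → ∀ {I} → IsTenseIdeal I → I ≐ U ⊎ I ≐ ｛ 𝟘 ｝
  B⇒tenseIdeal-trivial B {I} T with ∃≢⊎⊆｛｝ I 𝟘
  ... | inj₁ (x , Ix , x≢𝟘) =
    let q , d̂^qx≡𝟙 = CondB⇒d̂^≡𝟙 B x≢𝟘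
    in inj₁ (ideal∋𝟙⇒≐U (IsTenseIdeal.isIdeal T) (subst I d̂^qx≡𝟙 (d̂^-closed T q Ix)))
  ... | inj₂ I⊆𝟘 = inj₂ (ideal⊆｛𝟘｝⇒≐｛𝟘｝ (IsTenseIdeal.isIdeal T) I⊆𝟘)

  B⇒C : CondB → CondC
  B⇒C B = (λ S → mk⇔ (B⇒tenseFilter-trivial B) [ ≐U⇒isTenseFilter , ≐｛𝟙｝⇒isTenseFilter ]′)
        , (λ I → mk⇔ (B⇒tenseIdeal-trivial B) [ ≐U⇒isTenseIdeal , ≐｛𝟘｝⇒isTenseIdeal ]′)

  B⇒D : CondB → CondD
  B⇒D B x = mk⇔ d-fixed⇒𝟘⊎𝟙 [ (λ { refl → sym d𝟘≡𝟘 }) , (λ { refl → sym d𝟙≡𝟙 }) ]′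
    where
    d-fixed⇒𝟘⊎𝟙 : x ≡ d x → x ≡ 𝟘 ⊎ x ≡ 𝟙
    d-fixed⇒𝟘⊎𝟙 x≡dx with em {x ≡ 𝟙}
    ... | yes x≡𝟙 = inj₂ x≡𝟙
    ... | no x≢𝟙 = let p , d^px≡𝟘 = CondB⇒d^≡𝟘 B x≢𝟙
                   in inj₁ (trans (sym (d-fixed⇒d^-fixed x≡dx p)) d^px≡𝟘)

lemma4p18 : ∀ {c : Level} (𝒜 : TDLAlgebra c) → ExcludedMiddle c →
    (TDLAlgebra.CondA 𝒜 ⇔ TDLAlgebra.CondB 𝒜) ×
    (TDLAlgebra.CondB 𝒜 ⇔ TDLAlgebra.CondC 𝒜) ×
    (TDLAlgebra.IsFinite 𝒜 → TDLAlgebra.CondC 𝒜 ⇔ TDLAlgebra.CondD 𝒜)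
lemma4p18 𝒜 em = mk⇔ A⇒B B⇒A , mk⇔ B⇒C C⇒B , λ fin → mk⇔ (B⇒D ∘ C⇒B) (B⇒C ∘ D⇒B fin)
  where
  open TDLProperties 𝒜
  open Classical 𝒜 em
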